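{- Let $m\ge 2$, $k\ge 1$, and let $\mathfrak{s}$ be a white elementary star of degree $km$. Assume that $\mathfrak{s}$ has $r$ split-edges, of types $\tau_1,\dots,\tau_r$. Then $\sum_{i=1}^r\tau_i=km$.
   Context: A white split-edge is an edge joining a white unlabelled vertex to a pair of flags, one on each side of the edge, each flag carrying an integer label; if the labels are $l_1,l_2$ in clockwise order around the unlabelled vertex, its type is $l_2-l_1+1$. A white elementary star consists of a central white unlabelled vertex joined by edges to some labelled vertices (carrying integer labels) and to some white split-edges, such that, going clockwise around the central vertex: a labelled vertex of label $l$ is followed by a label $l-1$ (the label of the next labelled vertex, or the first flag of the next split-edge); and for a split-edge with flags labelled $l$ then $l'$ (clockwise), one has $l'\ge l$ and the next element is labelled $l'$ (vertex or first flag). Its degree is the degree of the central vertex (number of labelled vertices plus number of split-edges). Stars are considered up to translation of all labels. -}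

module Defs where

open import Data.Nat using (ℕ)
open import Data.Integer using (ℤ; _+_; _-_; _≤_; +_; 0ℤ; 1ℤ)
open import Data.List using (List; []; _∷_; _++_; foldr; length)
open import Data.List.Relation.Unary.All using (All)
open import Data.Product using (_×_)
open import Data.Unit using (⊤)
open import Data.Empty using (⊥)
open import Relation.Binary.PropositionalEquality using (_≡_)

-- An element attached to the central white unlabelled vertex of a star,
-- listed in clockwise order around the central vertex.
data Elem : Set where
  -- a labelled vertex carrying label l
  vert  : ℤ → Elem
  -- a white split-edge whose flags carry labels l₁ then l₂ (clockwise)
  split : ℤ → ℤ → Elem

firstLabel : Elem → ℤ
firstLabel (vert l)    = l
firstLabel (split l _) = l

nextLabel : Elem → ℤ
nextLabel (vert l)     = l - 1ℤ
nextLabel (split _ l′) = l′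

ValidElem : Elem → Set
ValidElem (vert _)     = ⊤
ValidElem (split l l′) = l ≤ l′

Linked : Elem → Elem → Set
Linked a b = nextLabel a ≡ firstLabel b

Consecutive : List Elem → Set
Consecutive []             = ⊤
Consecutive (_ ∷ [])       = ⊤
Consecutive (x ∷ y ∷ rest) = Linked x y × Consecutive (y ∷ rest)

-- A white elementary star, read clockwise from some starting element
-- (cyclically: the last element is followed by the first).
IsWhiteStar : List Elem → Set
IsWhiteStar []       = ⊥
IsWhiteStar (e ∷ es) = All ValidElem (e ∷ es) × Consecutive ((e ∷ es) ++ (e ∷ []))

-- degree = number of labelled vertices + number of split-edges
degree : List Elem → ℕ
degree = length

splitType : ℤ → ℤ → ℤ
splitType l₁ l₂ = (l₂ - l₁) + 1ℤ

splitTypes : List Elem → List ℤ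
splitTypes []               = []
splitTypes (vert _ ∷ es)    = splitTypes es
splitTypes (split l l′ ∷ es) = splitType l l′ ∷ splitTypes es

sumℤ : List ℤ → ℤ
sumℤ = foldr _+_ 0ℤ

-- Each element e contributes (nextLabel e − firstLabel e) + 1 to the sum of
-- the split types: a split-edge contributes its type, a labelled vertex
-- (l − 1) − l + 1 = 0.  Going once around the central vertex the differences
-- telescope to 0, so only the number of elements, the degree, survives.
module Submission where

open import Defs
open import Data.Nat using (ℕ; suc; _*_; _≤_)
open import Data.Integer using (ℤ; +_; _+_; _-_; 0ℤ; 1ℤ)
open import Data.Integer.Properties using (+-comm; +-inverseʳ; +-identityˡ; +-identityʳ)
open import Data.Integer.Tactic.RingSolver using (solve-∀)
open import Data.List using (List; []; _∷_; _++_; [_]; map; length)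
open import Data.Product using (_,_)
open import Relation.Binary.PropositionalEquality using (_≡_; refl; cong; sym)
open Relation.Binary.PropositionalEquality.≡-Reasoning

labelShift : Elem → ℤ
labelShift e = nextLabel e - firstLabel e

+-suc : ∀ n → + n + 1ℤ ≡ + suc n
+-suc n = +-comm (+ n) 1ℤ

sumℤ-splitTypes : ∀ es → sumℤ (splitTypes es) ≡ sumℤ (map labelShift es) + + length es
sumℤ-splitTypes [] = refl
sumℤ-splitTypes (vert l ∷ es) = begin
  sumℤ (splitTypes es)                        ≡⟨ sumℤ-splitTypes es ⟩
  a + n                                       ≡⟨ vertex-shift l a n ⟩
  (((l - 1ℤ) - l) + a) + (n + 1ℤ)             ≡⟨ cong (λ t → ((l - 1ℤ) - l + a) + t) (+-suc (length es)) ⟩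
  (((l - 1ℤ) - l) + a) + + length (vert l ∷ es) ∎
  where
  a = sumℤ (map labelShift es)
  n = + length es
  vertex-shift : ∀ l a n → a + n ≡ (((l - 1ℤ) - l) + a) + (n + 1ℤ)
  vertex-shift = solve-∀
sumℤ-splitTypes (split l l′ ∷ es) = begin
  splitType l l′ + sumℤ (splitTypes es)       ≡⟨ cong (λ t → splitType l l′ + t) (sumℤ-splitTypes es) ⟩
  ((l′ - l) + 1ℤ) + (a + n)                   ≡⟨ split-shift l l′ a n ⟩
  ((l′ - l) + a) + (n + 1ℤ)                   ≡⟨ cong (λ t → (l′ - l + a) + t) (+-suc (length es)) ⟩
  ((l′ - l) + a) + + length (split l l′ ∷ es) ∎
  where
  a = sumℤ (map labelShift es)
  n = + length es
  split-shift : ∀ l l′ a n → ((l′ - l) + 1ℤ) + (a + n) ≡ ((l′ - l) + a) + (n + 1ℤ)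
  split-shift = solve-∀

sumℤ-labelShift-telescopes : ∀ x xs y → Consecutive (x ∷ xs ++ [ y ]) →
                             sumℤ (map labelShift (x ∷ xs)) ≡ firstLabel y - firstLabel x
sumℤ-labelShift-telescopes x [] y (x→y , _) rewrite sym x→y = +-identityʳ (labelShift x)
sumℤ-labelShift-telescopes x (z ∷ zs) y (x→z , z⋯y)
  rewrite sumℤ-labelShift-telescopes z zs y z⋯y | sym x→z = telescope (nextLabel x) (firstLabel x) (firstLabel y)
  where
  telescope : ∀ a b c → (a - b) + (c - a) ≡ c - b
  telescope = solve-∀

sumℤ-splitTypes-star : ∀ s → IsWhiteStar s → sumℤ (splitTypes s) ≡ + degree s
sumℤ-splitTypes-star (e ∷ es) (_ , cyclic) = begin
  sumℤ (splitTypes (e ∷ es))                         ≡⟨ sumℤ-splitTypes (e ∷ es) ⟩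
  sumℤ (map labelShift (e ∷ es)) + + degree (e ∷ es) ≡⟨ cong (λ t → t + + degree (e ∷ es)) (sumℤ-labelShift-telescopes e es e cyclic) ⟩
  (firstLabel e - firstLabel e) + + degree (e ∷ es)  ≡⟨ cong (λ t → t + + degree (e ∷ es)) (+-inverseʳ (firstLabel e)) ⟩
  0ℤ + + degree (e ∷ es)                             ≡⟨ +-identityˡ _ ⟩
  + degree (e ∷ es)                                  ∎

lemma4 : (m k : ℕ) → 2 ≤ m → 1 ≤ k → (s : List Elem) → IsWhiteStar s →
           degree s ≡ k * m → sumℤ (splitTypes s) ≡ + (k * m)
lemma4 m k _ _ s star deg≡km = begin
  sumℤ (splitTypes s) ≡⟨ sumℤ-splitTypes-star s star ⟩
  + degree s          ≡⟨ cong +_ deg≡km ⟩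
  + (k * m)           ∎
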